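{- The order of promotion on increasing labelings of $\mathcal{Z}_3$ with labels in $[q]$ for $q \geq 3$ is $2q$.
   Context: $\mathcal{Z}_3$ is the zig-zag poset $x_1\lessdot x_2\gtrdot x_3$. Increasing labelings are $f:\mathcal{Z}_3\to[q]$ with $f(x)<f(y)$ whenever $x<y$. Promotion: replace labels $1$ by empty boxes; for $i=2,\dots,q$ slide boxes upward (a box at $x$ becomes $i$ if some $y\gtrdot x$ is labeled $i$, and that element becomes a box); replace boxes by $q+1$ and subtract $1$ from all labels. The order is the least $N$ with $\mathrm{Pro}^N$ the identity. -}

module Defs where

open import Data.Nat using (ℕ; zero; suc; _≤_; _<_; _∸_; _≡ᵇ_)
open import Data.Bool using (Bool; true; false; if_then_else_; _∧_; _∨_)
open import Data.Maybe using (Maybe; just; nothing)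
open import Data.Product using (_×_; _,_)
open import Function using (_∘_)
open import Relation.Binary.PropositionalEquality using (_≡_)
open import Relation.Nullary using (¬_)

-- The zig-zag poset Z₃ : x₁ ⋖ x₂ ⋗ x₃.  A labeling is a triple
-- (f x₁ , f x₂ , f x₃) of natural numbers.
Lab : Set
Lab = ℕ × ℕ × ℕ

IsIncLab : ℕ → Lab → Set
IsIncLab q (a , b , c) = (1 ≤ a) × (1 ≤ c) × (a < b) × (c < b) × (b ≤ q)

-- Intermediate state during promotion: nothing = empty box.
State : Set
State = Maybe ℕ × Maybe ℕ × Maybe ℕ

isBox : Maybe ℕ → Bool
isBox nothing  = true
isBox (just _) = false

isLabel : ℕ → Maybe ℕ → Bool
isLabel i nothing  = false
isLabel i (just v) = v ≡ᵇ i

boxOnes : ℕ → Maybe ℕ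
boxOnes v = if v ≡ᵇ 1 then nothing else just v

fill : ℕ → Maybe ℕ → Maybe ℕ
fill i nothing  = just i
fill i (just v) = just v

-- sliding step i: the only covering relations are x₁ ⋖ x₂ and x₃ ⋖ x₂.
-- If x₂ is labeled i and some element it covers is a box, every box
-- covered by x₂ becomes i and x₂ becomes a box.
slide : ℕ → State → State
slide i (ma , mb , mc) =
  if isLabel i mb ∧ (isBox ma ∨ isBox mc)
  then (fill i ma , nothing , fill i mc)
  else (ma , mb , mc)

slides : ℕ → ℕ → State → State
slides i zero    s = s
slides i (suc k) s = slides (suc i) k (slide i s)

-- replace boxes by q+1 and subtract 1 from all labels
finish : ℕ → Maybe ℕ → ℕ
finish q nothing  = q
finish q (just v) = v ∸ 1

pro : ℕ → Lab → Lab
pro q (a , b , c) with slides 2 (q ∸ 1) (boxOnes a , boxOnes b , boxOnes c)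
... | (ma , mb , mc) = (finish q ma , finish q mb , finish q mc)

iter : {A : Set} → (A → A) → ℕ → A → A
iter f zero    x = x
iter f (suc n) x = f (iter f n x)

ProPowIsId : ℕ → ℕ → Set
ProPowIsId q N = ∀ (f : Lab) → IsIncLab q f → iter (pro q) N f ≡ f

OrderOfPro : ℕ → ℕ → Set
OrderOfPro q N = (1 ≤ N) × ProPowIsId q N × (∀ M → 1 ≤ M → M < N → ¬ ProPowIsId q M)

{-# OPTIONS --safe #-}
module Submission where

-- Let f = (a , b , c) with a < c.  Promotion lowers all labels by one until a minimal element
-- reaches 1; at the next step that element takes the label just below x₂ and x₂ jumps to q.
-- With the gaps g₁ = c − a, g₂ = b − c, g₃ = q − b + a (summing to q) this gives
-- Pro^a f = (g₁ + g₂ , q , g₁), the mirror image of (g₁ , q , g₁ + g₂): a labeling of the same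
-- kind whose gaps are rotated to (g₂ , g₃ , g₁).  Two more jumps (after g₁ and g₂ steps) and
-- q − b plain decrements bring the gaps back with x₁ and x₃ exchanged, so Pro^q f is the mirror
-- image of f; for a = c both minimal elements jump together.  Hence Pro^(2q) = id.  No smaller
-- power is the identity: the symmetric labeling (1,2,1) needs exactly q steps to come back, and
-- (1,3,2) is not fixed by Pro^q.

open import Defs
open import Data.Nat using (ℕ; zero; suc; _+_; _*_; _∸_; _≤_; _<_; _≡ᵇ_; s≤s; z≤n)
open import Data.Nat.Properties
  using ( +-suc; +-identityʳ; +-comm; +-cancelˡ-<; ≤-refl; ≤-trans; <⇒≤; ≤⇒≯; <-cmp
        ; m≤m+n; n≤1+n; m≤n⇒m<n∨m≡n; m≤n⇒∃[o]m+o≡n )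
open import Data.Nat.Tactic.RingSolver using (solve)
open import Data.Bool using (true; false; _∧_; _∨_)
open import Data.Bool.Properties using (∨-comm; ∧-zeroʳ)
open import Data.Maybe using (nothing; just)
open import Data.Product using (_×_; _,_; ∃)
open import Data.List using (_∷_; [])
open import Data.Sum using (inj₁; inj₂)
open import Data.Empty using (⊥-elim)
open import Relation.Binary.PropositionalEquality
open import Relation.Binary.Definitions using (tri<; tri≈; tri>)
open import Relation.Nullary using (¬_)

≡ᵇ-refl : ∀ n → (n ≡ᵇ n) ≡ true
≡ᵇ-refl zero    = refl
≡ᵇ-refl (suc n) = ≡ᵇ-refl n

>⇒≡ᵇ-false : ∀ {m n} → n < m → (m ≡ᵇ n) ≡ false
>⇒≡ᵇ-false {suc m} {zero}  _         = refl
>⇒≡ᵇ-false {suc m} {suc n} (s≤s n<m) = >⇒≡ᵇ-false n<m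

m<n⇒∃[o]1≤o×m+o≡n : ∀ {m n} → m < n → ∃ λ o → 1 ≤ o × m + o ≡ n
m<n⇒∃[o]1≤o×m+o≡n {m} m<n with o , eq ← m≤n⇒∃[o]m+o≡n m<n = suc o , s≤s z≤n , trans (+-suc m o) eq

module _ {A : Set} (f : A → A) where

  iter-commute : ∀ {g : A → A} → (∀ x → f (g x) ≡ g (f x)) → ∀ n x → iter f n (g x) ≡ g (iter f n x)
  iter-commute comm zero    x = refl
  iter-commute comm (suc n) x = trans (cong f (iter-commute comm n x)) (comm (iter f n x))

  iter-+ : ∀ m n x → iter f (m + n) x ≡ iter f n (iter f m x)
  iter-+ zero    n x = refl
  iter-+ (suc m) n x = trans (cong f (iter-+ m n x)) (sym (iter-commute {g = f} (λ _ → refl) n (iter f m x)))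

mirror : {A : Set} → A × A × A → A × A × A
mirror (x , y , z) = (z , y , x)

slide-mirror : ∀ i s → slide i (mirror s) ≡ mirror (slide i s)
slide-mirror i (ma , mb , mc) rewrite ∨-comm (isBox mc) (isBox ma)
  with isLabel i mb ∧ (isBox ma ∨ isBox mc)
... | true  = refl
... | false = refl

slides-mirror : ∀ i k s → slides i k (mirror s) ≡ mirror (slides i k s)
slides-mirror i zero    s = refl
slides-mirror i (suc k) s rewrite slide-mirror i s = slides-mirror (suc i) k (slide i s)

pro-mirror : ∀ q f → pro q (mirror f) ≡ mirror (pro q f)
pro-mirror q (a , b , c) rewrite slides-mirror 2 (q ∸ 1) (boxOnes a , boxOnes b , boxOnes c) = refl

slides-boxless : ∀ i k a mb c → slides i k (just a , mb , just c) ≡ (just a , mb , just c)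
slides-boxless i zero    a mb c = refl
slides-boxless i (suc k) a mb c rewrite ∧-zeroʳ (isLabel i mb) = slides-boxless (suc i) k a mb c

slides-vacated : ∀ i k ma mc → slides i k (ma , nothing , mc) ≡ (ma , nothing , mc)
slides-vacated i zero    ma mc = refl
slides-vacated i (suc k) ma mc = slides-vacated (suc i) k ma mc

slides-hit : ∀ i k {b ma mc} → (isBox ma ∨ isBox mc) ≡ true → i ≤ b → b < i + k →
             slides i k (ma , just b , mc) ≡ (fill b ma , nothing , fill b mc)
slides-hit i zero    _   i≤b b<i+0 = ⊥-elim (≤⇒≯ i≤b (subst (_ <_) (+-identityʳ i) b<i+0))
slides-hit i (suc k) {b} {ma} {mc} box i≤b b<i+k with m≤n⇒m<n∨m≡n i≤b
... | inj₁ i<b rewrite >⇒≡ᵇ-false i<b = slides-hit (suc i) k box i<b (subst (b <_) (+-suc i k) b<i+k)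
... | inj₂ refl rewrite ≡ᵇ-refl i | box = slides-vacated (suc i) k (fill i ma) (fill i mc)

pro-pred : ∀ q a b c → pro q (suc (suc a) , suc (suc b) , suc (suc c)) ≡ (suc a , suc b , suc c)
pro-pred q a b c rewrite slides-boxless 2 (q ∸ 1) (suc (suc a)) (just (suc (suc b))) (suc (suc c)) = refl

pro-jumpˡ : ∀ q b c → suc (suc b) ≤ q → pro q (1 , suc (suc b) , suc (suc c)) ≡ (suc b , q , suc c)
pro-jumpˡ (suc q) b c (s≤s b<q)
  rewrite slides-hit 2 q {ma = nothing} {just (suc (suc c))} refl (s≤s (s≤s z≤n)) (s≤s (s≤s b<q)) = refl

pro-jump² : ∀ q b → suc (suc b) ≤ q → pro q (1 , suc (suc b) , 1) ≡ (suc b , q , suc b)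
pro-jump² (suc q) b (s≤s b<q)
  rewrite slides-hit 2 q {ma = nothing} {nothing} refl (s≤s (s≤s z≤n)) (s≤s (s≤s b<q)) = refl

iter-pro-mirror : ∀ {q n s t} → iter (pro q) n s ≡ t → iter (pro q) n (mirror s) ≡ mirror t
iter-pro-mirror {q} {n} {s} eq = trans (iter-commute (pro q) (pro-mirror q) n s) (cong mirror eq)

iter-pro-pred : ∀ q k {a b c} → 1 ≤ a → 1 ≤ b → 1 ≤ c → iter (pro q) k (a + k , b + k , c + k) ≡ (a , b , c)
iter-pro-pred q zero {a} {b} {c} _ _ _ rewrite +-identityʳ a | +-identityʳ b | +-identityʳ c = refl
iter-pro-pred q (suc k) {suc a} {suc b} {suc c} _ _ _
  rewrite +-suc a k | +-suc b k | +-suc c k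
        | iter-pro-pred q k {suc (suc a)} {suc (suc b)} {suc (suc c)} (s≤s z≤n) (s≤s z≤n) (s≤s z≤n)
  = pro-pred q a b c

iter-suc-pro-pred : ∀ q n a b c →
  iter (pro q) (suc n) (suc (suc a) , suc (suc b) , suc (suc c)) ≡ iter (pro q) n (suc a , suc b , suc c)
iter-suc-pro-pred q n a b c = trans (iter-+ (pro q) 1 n _) (cong (iter (pro q) n) (pro-pred q a b c))

iter-pro-jumpˡ : ∀ {q} p {g₁ g₂ b} → 1 ≤ p → 1 ≤ g₁ → p + g₁ + g₂ ≡ b → b ≤ q →
                 iter (pro q) p (p , b , p + g₁) ≡ (g₁ + g₂ , q , g₁)
iter-pro-jumpˡ 1 {suc g₁} {g₂} _ (s≤s z≤n) refl b≤q = pro-jumpˡ _ (g₁ + g₂) g₁ b≤q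
iter-pro-jumpˡ {q} (suc (suc p)) {g₁} {g₂} _ 1≤g₁ refl b≤q =
  trans (iter-suc-pro-pred q (suc p) p (p + g₁ + g₂) (p + g₁))
        (iter-pro-jumpˡ (suc p) (s≤s z≤n) 1≤g₁ refl (≤-trans (n≤1+n _) b≤q))

iter-pro-jumpʳ : ∀ {q} p {g₁ g₂ b} → 1 ≤ p → 1 ≤ g₁ → p + g₁ + g₂ ≡ b → b ≤ q →
                 iter (pro q) p (p + g₁ , b , p) ≡ (g₁ , q , g₁ + g₂)
iter-pro-jumpʳ {q} p {g₁} {b = b} 1≤p 1≤g₁ b≡ b≤q =
  iter-pro-mirror {q} {p} {p , b , p + g₁} (iter-pro-jumpˡ p 1≤p 1≤g₁ b≡ b≤q)

iter-pro-jump² : ∀ {q} p {g b} → 1 ≤ p → 1 ≤ g → p + g ≡ b → b ≤ q →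
                 iter (pro q) p (p , b , p) ≡ (g , q , g)
iter-pro-jump² 1 {suc g} _ (s≤s z≤n) refl b≤q = pro-jump² _ g b≤q
iter-pro-jump² {q} (suc (suc p)) {g} _ 1≤g refl b≤q =
  trans (iter-suc-pro-pred q (suc p) p (p + g) p)
        (iter-pro-jump² (suc p) (s≤s z≤n) 1≤g refl (≤-trans (n≤1+n _) b≤q))

module OrbitReasoning (q : ℕ) where

  infix  1 begin⟨_⟩_
  infixr 2 _↝⟨_∣_⟩_ _≡⟨_⟩_
  infix  3 _∎

  -- A record rather than the bare equation, so that the step count n is recovered by
  -- unification instead of being lost when iter (pro q) n s reduces.
  record _↝[_]_ (s : Lab) (n : ℕ) (t : Lab) : Set where
    constructor reaches
    field iter-pro≡ : iter (pro q) n s ≡ t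

  begin⟨_⟩_ : ∀ {s t m n} → m ≡ n → s ↝[ m ] t → iter (pro q) n s ≡ t
  begin⟨ refl ⟩ reaches s↝t = s↝t

  _↝⟨_∣_⟩_ : ∀ s n {m t u} → iter (pro q) n s ≡ t → t ↝[ m ] u → s ↝[ n + m ] u
  _↝⟨_∣_⟩_ s n {m} s↝t (reaches t↝u) =
    reaches (trans (iter-+ (pro q) n m s) (trans (cong (iter (pro q) m) s↝t) t↝u))

  _≡⟨_⟩_ : ∀ s {m t u} → s ≡ t → t ↝[ m ] u → s ↝[ m ] u
  s ≡⟨ refl ⟩ t↝u = t↝u

  _∎ : ∀ s → s ↝[ 0 ] s
  s ∎ = reaches refl

pro^q[a,b,c]≡[c,b,a] : ∀ {q a b c} → 1 ≤ a → a < c → c < b → b ≤ q → iter (pro q) q (a , b , c) ≡ (c , b , a)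
pro^q[a,b,c]≡[c,b,a] {a = a} 1≤a a<c c<b b≤q
  with m<n⇒∃[o]1≤o×m+o≡n a<c | m<n⇒∃[o]1≤o×m+o≡n c<b | m≤n⇒∃[o]m+o≡n b≤q
... | g₁ , 1≤g₁ , refl | g₂ , 1≤g₂ , refl | w , refl = begin⟨ steps ⟩
    (a , b , a + g₁)          ↝⟨ a  ∣ iter-pro-jumpˡ a 1≤a 1≤g₁ refl (m≤m+n b w) ⟩
    (g₁ + g₂ , q , g₁)        ↝⟨ g₁ ∣ iter-pro-jumpʳ g₁ 1≤g₁ 1≤g₂ gaps₂ ≤-refl ⟩
    (g₂ , q , g₂ + (a + w))   ↝⟨ g₂ ∣ iter-pro-jumpˡ g₂ 1≤g₂ (≤-trans 1≤a (m≤m+n a w)) gaps₃ ≤-refl ⟩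
    (a + w + g₁ , q , a + w)  ≡⟨ cong (_, q , a + w) gaps₄ ⟩
    (a + g₁ + w , q , a + w)  ↝⟨ w  ∣ iter-pro-pred q w 1≤c (≤-trans 1≤c (m≤m+n _ g₂)) 1≤a ⟩
    (a + g₁ , b , a)          ∎
  where
  open OrbitReasoning (a + g₁ + g₂ + w)
  b q : ℕ
  b = a + g₁ + g₂
  q = b + w
  1≤c : 1 ≤ a + g₁
  1≤c = ≤-trans 1≤a (m≤m+n a g₁)
  steps : a + (g₁ + (g₂ + (w + 0))) ≡ a + g₁ + g₂ + w
  steps = solve (a ∷ g₁ ∷ g₂ ∷ w ∷ [])
  gaps₂ : g₁ + g₂ + (a + w) ≡ a + g₁ + g₂ + w
  gaps₂ = solve (a ∷ g₁ ∷ g₂ ∷ w ∷ [])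
  gaps₃ : g₂ + (a + w) + g₁ ≡ a + g₁ + g₂ + w
  gaps₃ = solve (a ∷ g₁ ∷ g₂ ∷ w ∷ [])
  gaps₄ : a + w + g₁ ≡ a + g₁ + w
  gaps₄ = solve (a ∷ g₁ ∷ w ∷ [])

pro^q[a,b,a]≡[a,b,a] : ∀ {q a b} → 1 ≤ a → a < b → b ≤ q → iter (pro q) q (a , b , a) ≡ (a , b , a)
pro^q[a,b,a]≡[a,b,a] {a = a} 1≤a a<b b≤q with m<n⇒∃[o]1≤o×m+o≡n a<b | m≤n⇒∃[o]m+o≡n b≤q
... | g , 1≤g , refl | w , refl = begin⟨ steps ⟩
    (a , b , a)          ↝⟨ a ∣ iter-pro-jump² a 1≤a 1≤g refl (m≤m+n b w) ⟩
    (g , q , g)          ↝⟨ g ∣ iter-pro-jump² g 1≤g (≤-trans 1≤a (m≤m+n a w)) gap ≤-refl ⟩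
    (a + w , q , a + w)  ↝⟨ w ∣ iter-pro-pred q w 1≤a (≤-trans 1≤a (m≤m+n a g)) 1≤a ⟩
    (a , b , a)          ∎
  where
  open OrbitReasoning (a + g + w)
  b q : ℕ
  b = a + g
  q = b + w
  steps : a + (g + (w + 0)) ≡ a + g + w
  steps = solve (a ∷ g ∷ w ∷ [])
  gap : g + (a + w) ≡ a + g + w
  gap = solve (a ∷ g ∷ w ∷ [])

IsIncLab-mirror : ∀ {q f} → IsIncLab q f → IsIncLab q (mirror f)
IsIncLab-mirror (1≤a , 1≤c , a<b , c<b , b≤q) = 1≤c , 1≤a , c<b , a<b , b≤q

pro^q≡mirror : ∀ {q f} → IsIncLab q f → iter (pro q) q f ≡ mirror f
pro^q≡mirror {q} {a , b , c} (1≤a , 1≤c , a<b , c<b , b≤q) with <-cmp a c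
... | tri< a<c _ _  = pro^q[a,b,c]≡[c,b,a] 1≤a a<c c<b b≤q
... | tri≈ _ refl _ = pro^q[a,b,a]≡[a,b,a] 1≤a a<b b≤q
... | tri> _ _ c<a  = iter-pro-mirror {q} {q} {c , b , a} (pro^q[a,b,c]≡[c,b,a] 1≤c c<a a<b b≤q)

pro^2q≡id : ∀ q → ProPowIsId q (2 * q)
pro^2q≡id q f f-inc = begin⟨ refl ⟩
    f         ↝⟨ q ∣ pro^q≡mirror f-inc ⟩
    mirror f  ↝⟨ q ∣ pro^q≡mirror (IsIncLab-mirror f-inc) ⟩
    f         ∎
  where open OrbitReasoning q

pro^[q+r]≡pro^r∘mirror : ∀ {q f} r → IsIncLab q f → iter (pro q) (q + r) f ≡ iter (pro q) r (mirror f)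
pro^[q+r]≡pro^r∘mirror {q} {f} r f-inc = trans (iter-+ (pro q) q r f) (cong (iter (pro q) r) (pro^q≡mirror f-inc))

IsIncLab-[1,2,1] : ∀ {q} → 2 ≤ q → IsIncLab q (1 , 2 , 1)
IsIncLab-[1,2,1] 2≤q = s≤s z≤n , s≤s z≤n , ≤-refl , ≤-refl , 2≤q

IsIncLab-[1,3,2] : ∀ {q} → 3 ≤ q → IsIncLab q (1 , 3 , 2)
IsIncLab-[1,3,2] 3≤q = s≤s z≤n , s≤s z≤n , s≤s (s≤s z≤n) , ≤-refl , 3≤q

pro^[2+j][1,2,1] : ∀ {q} j t → 3 + t + j ≡ q → iter (pro q) (2 + j) (1 , 2 , 1) ≡ (2 + t , 3 + t , 2 + t)
pro^[2+j][1,2,1] j t refl = begin⟨ cong (2 +_) (+-identityʳ j) ⟩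
    (1 , 2 , 1)                  ↝⟨ 1 ∣ pro-jump² q 0 (s≤s (s≤s z≤n)) ⟩
    (1 , q , 1)                  ↝⟨ 1 ∣ pro-jump² q (suc (t + j)) ≤-refl ⟩
    (2 + t + j , q , 2 + t + j)  ↝⟨ j ∣ iter-pro-pred q j (s≤s z≤n) (s≤s z≤n) (s≤s z≤n) ⟩
    (2 + t , 3 + t , 2 + t)      ∎
  where
  q : ℕ
  q = 3 + t + j
  open OrbitReasoning q

pro^r[1,2,1]≢[1,2,1] : ∀ {q r} → 3 ≤ q → 1 ≤ r → r < q → iter (pro q) r (1 , 2 , 1) ≢ (1 , 2 , 1)
pro^r[1,2,1]≢[1,2,1] {q} {r = 1} (s≤s (s≤s (s≤s z≤n))) _ _ eq
  with trans (sym (pro-jump² q 0 (s≤s (s≤s z≤n)))) eq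
... | ()
pro^r[1,2,1]≢[1,2,1] {r = suc (suc j)} _ _ r<q eq with t , 3+j+t≡q ← m≤n⇒∃[o]m+o≡n r<q
  with trans (sym (pro^[2+j][1,2,1] j t (trans (cong (3 +_) (+-comm t j)) 3+j+t≡q))) eq
... | ()

pro^q[1,3,2]≢[1,3,2] : ∀ {q} → 3 ≤ q → iter (pro q) q (1 , 3 , 2) ≢ (1 , 3 , 2)
pro^q[1,3,2]≢[1,3,2] 3≤q eq with trans (sym (pro^q≡mirror (IsIncLab-[1,3,2] 3≤q))) eq
... | ()

pro-order-minimal : ∀ {q} → 3 ≤ q → ∀ M → 1 ≤ M → M < 2 * q → ¬ ProPowIsId q M
pro-order-minimal {q} 3≤q M 1≤M M<2q pro^M≡id with <-cmp M q
... | tri< M<q _ _  = pro^r[1,2,1]≢[1,2,1] 3≤q 1≤M M<q (pro^M≡id _ (IsIncLab-[1,2,1] (<⇒≤ 3≤q)))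
... | tri≈ _ refl _ = pro^q[1,3,2]≢[1,3,2] 3≤q (pro^M≡id _ (IsIncLab-[1,3,2] 3≤q))
... | tri> _ _ q<M with r , 1≤r , refl ← m<n⇒∃[o]1≤o×m+o≡n q<M =
  pro^r[1,2,1]≢[1,2,1] 3≤q 1≤r r<q (trans (sym (pro^[q+r]≡pro^r∘mirror r [1,2,1]-inc)) (pro^M≡id _ [1,2,1]-inc))
  where
  [1,2,1]-inc : IsIncLab q (1 , 2 , 1)
  [1,2,1]-inc = IsIncLab-[1,2,1] (<⇒≤ 3≤q)
  r<q : r < q
  r<q = subst (r <_) (+-identityʳ q) (+-cancelˡ-< q r (q + 0) M<2q)

corollary4p1 : ∀ (q : ℕ) → 3 ≤ q → OrderOfPro q (2 * q)
corollary4p1 q 3≤q = ≤-trans (s≤s z≤n) (≤-trans 3≤q (m≤m+n q (q + 0))) , pro^2q≡id q , pro-order-minimal 3≤q
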